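{- For any $n\geq 1$, $\mathrm{qc}(n, n, n) \geq \frac{1}{2} n (n-1)$.
   Context: Search game on the grid $S_1\times\cdots\times S_d$ with $S_i=\{0,\ldots,n_i-1\}$: Adversary fixes a target $t$; Algorithm queries a point $q$; if $q\neq t$, Adversary answers for every coordinate $i$ one of $t_i<q_i$ or $t_i>q_i$, at least one of these $d$ inequalities being true, and Algorithm does not learn which one. $\mathrm{qc}(n_1,\ldots,n_d)$ denotes the minimum number of queries that guarantees finding the target (the query complexity). Here $d=3$. -}

module Defs where

open import Data.Nat using (ℕ; zero; suc; _≤_)
open import Data.Fin using (Fin; _<_)
open import Data.Vec using (Vec; lookup)
open import Data.Bool using (Bool; true; false)
open import Data.Product using (Σ; ∃; _×_)
open import Data.Sum using (_⊎_)
open import Data.Empty using (⊥)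
open import Relation.Binary.PropositionalEquality using (_≡_)

Point : (d : ℕ) → Vec ℕ d → Set
Point d ns = (i : Fin d) → Fin (lookup ns i)

-- An answer gives, for every coordinate i, one inequality:
--   true  means "t_i < q_i",   false means "t_i > q_i".
Answer : ℕ → Set
Answer d = Fin d → Bool

Holds : ∀ {d ns} → Point d ns → Point d ns → Answer d → Fin d → Set
Holds t q a i with a i
... | true  = t i < q i
... | false = q i < t i

Legal : ∀ {d ns} → Point d ns → Point d ns → Answer d → Set
Legal {d} {ns} t q a = ∃ λ i → Holds {d} {ns} t q a i

-- Adaptive algorithm = decision tree: either stop, or query a point and
-- continue depending on the (whole) answer vector received.
data Alg (d : ℕ) (ns : Vec ℕ d) : Set where
  stop : Alg d ns
  ask  : Point d ns → (Answer d → Alg d ns) → Alg d ns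

FindsWithin : ∀ {d ns} → Alg d ns → Point d ns → ℕ → Set
FindsWithin stop      t k       = ⊥
FindsWithin (ask q f) t zero    = ⊥
FindsWithin {d} {ns} (ask q f) t (suc k) =
  (∀ i → q i ≡ t i) ⊎ (∀ a → Legal {d} {ns} t q a → FindsWithin (f a) t k)

Solvable : (d : ℕ) → Vec ℕ d → ℕ → Set
Solvable d ns k = Σ (Alg d ns) λ A → ∀ (t : Point d ns) → FindsWithin A t k

module Submission where

open import Defs
open import Data.Nat using (ℕ; _≤_; _*_; _∸_)
open import Data.Vec using (_∷_; [])

open import Algebra.Definitions.RawMonoid Data.Nat.+-0-rawMonoid using (sum)
open import Data.Bool using (Bool; true; false)
open import Data.Empty using (⊥-elim)
open import Data.Fin using (Fin; zero; suc; toℕ; fromℕ<; splitAt; _↑ˡ_; _↑ʳ_)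
open import Data.Fin.Properties
  using (toℕ-injective; toℕ<n; fromℕ<-injective; toℕ-fromℕ<; splitAt⁻¹-↑ˡ; splitAt⁻¹-↑ʳ;
         any?; injective⇒≤)
  renaming (_<?_ to _<ᶠ?_)
open import Data.List using (List; []; _∷_; length; lookup)
open import Data.List.Relation.Unary.Any using (Any; here; there; index)
open import Data.List.Relation.Unary.Any.Properties using (lookup-index)
open import Data.Nat using (zero; suc; _+_; _<_; _≤?_; z≤n; s≤s; s≤s⁻¹)
open import Data.Nat.Properties
open import Data.Product using (_×_; _,_; proj₁; uncurry)
open import Data.Sum using (_⊎_; inj₁; inj₂)
open import Data.Vec using (Vec)
open import Data.Vec.Functional using (Vector)
open import Function using (_∘_)
open import Relation.Nullary using (yes; no; does; contradiction)
open import Relation.Nullary.Decidable using (dec-true; dec-false)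
open import Relation.Binary.PropositionalEquality

-- An adversary that fixes its answer to every query in advance forces the
-- algorithm along a single line of play, so that line must visit every target
-- against which those answers are legal.  Answering "every t_i < q_i" exactly
-- when q lies on or above the plane x + y + z = n - 1 (and "every t_i > q_i"
-- below it) is legal against every target on that plane, which in the cube
-- {0,…,n-1}³ holds n(n+1)/2 points; hence qc(n,n,n) ≥ n(n+1)/2.

+-squeeze : ∀ {a b a′ b′} → a ≤ a′ → b ≤ b′ → a′ + b′ ≤ a + b → a ≡ a′ × b ≡ b′
+-squeeze {a} {b} {a′} {b′} a≤a′ b≤b′ sum≤ =
  ≤-antisym a≤a′ (+-cancelʳ-≤ b a′ a (≤-trans (+-monoʳ-≤ a′ b≤b′) sum≤)) ,
  ≤-antisym b≤b′ (+-cancelˡ-≤ a b′ b (≤-trans (+-monoˡ-≤ b′ a≤a′) sum≤))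

sum-mono-≤ : ∀ {d} {f g : Vector ℕ d} → (∀ i → f i ≤ g i) → sum f ≤ sum g
sum-mono-≤ {zero}  f≤g = z≤n
sum-mono-≤ {suc d} f≤g = +-mono-≤ (f≤g zero) (sum-mono-≤ (f≤g ∘ suc))

sum-squeeze : ∀ {d} {f g : Vector ℕ d} → (∀ i → f i ≤ g i) → sum g ≤ sum f → ∀ i → f i ≡ g i
sum-squeeze {suc d} f≤g sum≤ with +-squeeze (f≤g zero) (sum-mono-≤ (f≤g ∘ suc)) sum≤
... | head≡ , tail≡ = λ where
  zero    → head≡
  (suc i) → sum-squeeze (f≤g ∘ suc) (≤-reflexive (sym tail≡)) i

Adversary : (d : ℕ) → Vec ℕ d → Set
Adversary d ns = Point d ns → Answer d

module Search {d : ℕ} {ns : Vec ℕ d} where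

  infix 4 _≋_
  _≋_ : Point d ns → Point d ns → Set
  q ≋ t = ∀ i → q i ≡ t i

  Truthful : Adversary d ns → Point d ns → Set
  Truthful adv t = ∀ q → q ≋ t ⊎ Legal {d} {ns} t q (adv q)

  queries : Alg d ns → Adversary d ns → ℕ → List (Point d ns)
  queries stop      adv k       = []
  queries (ask q f) adv zero    = []
  queries (ask q f) adv (suc k) = q ∷ queries (f (adv q)) adv k

  length-queries≤ : ∀ A adv k → length (queries A adv k) ≤ k
  length-queries≤ stop      adv k       = z≤n
  length-queries≤ (ask q f) adv zero    = z≤n
  length-queries≤ (ask q f) adv (suc k) = s≤s (length-queries≤ (f (adv q)) adv k)

  truthful⇒queried : ∀ A adv k {t} → Truthful adv t → FindsWithin A t k →
                     Any (_≋ t) (queries A adv k)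
  truthful⇒queried (ask q f) adv (suc k) truthful (inj₁ q≋t) = here q≋t
  truthful⇒queried (ask q f) adv (suc k) truthful (inj₂ finds) with truthful q
  ... | inj₁ q≋t  = here q≋t
  ... | inj₂ legal = there (truthful⇒queried (f (adv q)) adv k truthful (finds (adv q) legal))

  truthful-targets≤ : ∀ {N k} (adv : Adversary d ns) (ts : Fin N → Point d ns) →
                      (∀ j → Truthful adv (ts j)) → (∀ {i j} → ts i ≋ ts j → i ≡ j) →
                      Solvable d ns k → N ≤ k
  truthful-targets≤ {k = k} adv ts truthful ts-injective (A , finds) =
    ≤-trans (injective⇒≤ position-injective) (length-queries≤ A adv k)
    where
    found : ∀ j → Any (_≋ ts j) (queries A adv k)
    found j = truthful⇒queried A adv k (truthful j) (finds (ts j))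

    position-injective : ∀ {i j} → index (found i) ≡ index (found j) → i ≡ j
    position-injective {i} {j} same = ts-injective λ x →
      trans (sym (lookup-index (found i) x))
            (trans (cong (λ p → lookup (queries A adv k) p x) same) (lookup-index (found j) x))

  height : Point d ns → ℕ
  height q = sum (λ i → toℕ (q i))

  uniform : Bool → Answer d
  uniform b _ = b

  hyperplane : ℕ → Adversary d ns
  hyperplane c q = uniform (does (c ≤? height q))

  height≤⇒≋⊎legal : ∀ {t q : Point d ns} → height t ≤ height q →
                    q ≋ t ⊎ Legal {d} {ns} t q (uniform true)
  height≤⇒≋⊎legal {t} {q} ht≤hq with any? (λ i → t i <ᶠ? q i)
  ... | yes below = inj₂ below
  ... | no ¬below = inj₁ λ i → toℕ-injective (sum-squeeze (λ i → ≮⇒≥ (¬below ∘ (i ,_))) ht≤hq i)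

  height>⇒legal : ∀ {t q : Point d ns} → height q < height t → Legal {d} {ns} t q (uniform false)
  height>⇒legal {t} {q} hq<ht with any? (λ i → q i <ᶠ? t i)
  ... | yes above = above
  ... | no ¬above = contradiction (sum-mono-≤ (λ i → ≮⇒≥ (¬above ∘ (i ,_)))) (<⇒≱ hq<ht)

  -- The answer does (c ≤? height q) computes to a _≤ᵇ_ test, which a with on the
  -- decision cannot abstract; dec-true and dec-false bridge the gap.
  hyperplane-truthful : ∀ {c} {t : Point d ns} → height t ≡ c → Truthful (hyperplane c) t
  hyperplane-truthful {t = t} refl q with height t ≤? height q
  ... | yes ht≤hq = subst (λ b → q ≋ t ⊎ Legal {d} {ns} t q (uniform b))
                          (sym (dec-true (height t ≤? height q) ht≤hq))
                          (height≤⇒≋⊎legal ht≤hq)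
  ... | no ht≰hq  = inj₂ (subst (Legal {d} {ns} t q ∘ uniform)
                                (sym (dec-false (height t ≤? height q) ht≰hq))
                                (height>⇒legal (≰⇒> ht≰hq)))

triangular : ℕ → ℕ
triangular zero    = 0
triangular (suc m) = suc m + triangular m

2*triangular : ∀ n → 2 * triangular n ≡ n * suc n
2*triangular zero    = refl
2*triangular (suc n) = begin
  2 * (suc n + triangular n)      ≡⟨ *-distribˡ-+ 2 (suc n) (triangular n) ⟩
  2 * suc n + 2 * triangular n    ≡⟨ cong (2 * suc n +_) (2*triangular n) ⟩
  2 * suc n + n * suc n           ≡⟨ *-distribʳ-+ (suc n) 2 n ⟨
  (2 + n) * suc n                 ≡⟨ *-comm (2 + n) (suc n) ⟩
  suc n * suc (suc n)             ∎
  where open ≡-Reasoning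

antidiagonal : ∀ {m} (x : Fin (suc m)) → toℕ x + (m ∸ toℕ x) ≡ m
antidiagonal x = m+[n∸m]≡n (s≤s⁻¹ (toℕ<n x))

triangle : (m : ℕ) → Fin (triangular m) → ℕ × ℕ
triangle (suc m) i with splitAt (suc m) i
... | inj₁ x = toℕ x , m ∸ toℕ x
... | inj₂ j = triangle m j

triangle-sum< : ∀ m i → uncurry _+_ (triangle m i) < m
triangle-sum< (suc m) i with splitAt (suc m) i
... | inj₁ x = s≤s (≤-reflexive (antidiagonal x))
... | inj₂ j = m<n⇒m<1+n (triangle-sum< m j)

antidiagonal∉triangle : ∀ {m} (x : Fin (suc m)) j → (toℕ x , m ∸ toℕ x) ≢ triangle m j
antidiagonal∉triangle x j same =
  <-irrefl (trans (sym (cong (uncurry _+_) same)) (antidiagonal x)) (triangle-sum< _ j)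

triangle-injective : ∀ m {i j} → triangle m i ≡ triangle m j → i ≡ j
triangle-injective (suc m) {i} {j} same with splitAt (suc m) i in ei | splitAt (suc m) j in ej
... | inj₁ x | inj₁ y = begin
  i                   ≡⟨ splitAt⁻¹-↑ˡ ei ⟨
  x ↑ˡ triangular m   ≡⟨ cong (_↑ˡ triangular m) (toℕ-injective (cong proj₁ same)) ⟩
  y ↑ˡ triangular m   ≡⟨ splitAt⁻¹-↑ˡ ej ⟩
  j                   ∎
  where open ≡-Reasoning
... | inj₁ x | inj₂ j′ = ⊥-elim (antidiagonal∉triangle x j′ same)
... | inj₂ i′ | inj₁ y = ⊥-elim (antidiagonal∉triangle y i′ (sym same))
... | inj₂ i′ | inj₂ j′ = begin
  i              ≡⟨ splitAt⁻¹-↑ʳ ei ⟨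
  suc m ↑ʳ i′    ≡⟨ cong (suc m ↑ʳ_) (triangle-injective m same) ⟩
  suc m ↑ʳ j′    ≡⟨ splitAt⁻¹-↑ʳ ej ⟩
  j              ∎
  where open ≡-Reasoning

cube : ℕ → Vec ℕ 3
cube n = n ∷ n ∷ n ∷ []

module _ (m : ℕ) where
  open Search {3} {cube (suc m)}

  planePoint : (xy : ℕ × ℕ) → uncurry _+_ xy ≤ m → Point 3 (cube (suc m))
  planePoint (x , y) x+y≤m = λ where
    zero             → fromℕ< (s≤s (≤-trans (m≤m+n x y) x+y≤m))
    (suc zero)       → fromℕ< (s≤s (≤-trans (m≤n+m y x) x+y≤m))
    (suc (suc zero)) → fromℕ< (s≤s (m∸n≤m m (x + y)))

  height-planePoint : ∀ xy (xy≤m : uncurry _+_ xy ≤ m) → height (planePoint xy xy≤m) ≡ m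
  height-planePoint (x , y) x+y≤m
    rewrite toℕ-fromℕ< (s≤s (≤-trans (m≤m+n x y) x+y≤m))
          | toℕ-fromℕ< (s≤s (≤-trans (m≤n+m y x) x+y≤m))
          | toℕ-fromℕ< (s≤s (m∸n≤m m (x + y))) = begin
    x + (y + (m ∸ (x + y) + 0))   ≡⟨ cong (λ z → x + (y + z)) (+-identityʳ (m ∸ (x + y))) ⟩
    x + (y + (m ∸ (x + y)))       ≡⟨ +-assoc x y (m ∸ (x + y)) ⟨
    x + y + (m ∸ (x + y))         ≡⟨ m+[n∸m]≡n x+y≤m ⟩
    m                             ∎
    where open ≡-Reasoning

  planePoint-injective : ∀ {xy xy′} (p : uncurry _+_ xy ≤ m) (p′ : uncurry _+_ xy′ ≤ m) →
                         planePoint xy p ≋ planePoint xy′ p′ → xy ≡ xy′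
  planePoint-injective {x , y} {x′ , y′} p p′ same = cong₂ _,_
    (fromℕ<-injective x x′ _ _ (same zero))
    (fromℕ<-injective y y′ _ _ (same (suc zero)))

  triangle-sum≤ : ∀ i → uncurry _+_ (triangle (suc m) i) ≤ m
  triangle-sum≤ i = s≤s⁻¹ (triangle-sum< (suc m) i)

  triangularPoint : Fin (triangular (suc m)) → Point 3 (cube (suc m))
  triangularPoint i = planePoint (triangle (suc m) i) (triangle-sum≤ i)

  triangularPoint-injective : ∀ {i j} → triangularPoint i ≋ triangularPoint j → i ≡ j
  triangularPoint-injective {i} {j} same =
    triangle-injective (suc m) (planePoint-injective (triangle-sum≤ i) (triangle-sum≤ j) same)

  triangular≤qc : ∀ k → Solvable 3 (cube (suc m)) k → triangular (suc m) ≤ k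
  triangular≤qc k =
    truthful-targets≤ (hyperplane m) triangularPoint
      (λ i → hyperplane-truthful (height-planePoint (triangle (suc m) i) (triangle-sum≤ i)))
      triangularPoint-injective

corollary10 : ∀ (n : ℕ) → 1 ≤ n →
    ∀ k → Solvable 3 (n ∷ n ∷ n ∷ []) k → n * (n ∸ 1) ≤ 2 * k
corollary10 (suc m) _ k solvable = begin
  suc m * m                ≤⟨ *-monoʳ-≤ (suc m) (m≤n+m m 2) ⟩
  suc m * suc (suc m)      ≡⟨ 2*triangular (suc m) ⟨
  2 * triangular (suc m)   ≤⟨ *-monoʳ-≤ 2 (triangular≤qc m k solvable) ⟩
  2 * k                    ∎
  where open ≤-Reasoning
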